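{- Let $A$ be a complete MV-algebra and let $B(A)$ be its Boolean center. For every $x\in A$, if $x$ is a compact element of $A$, then $x^{\ast\ast}$ is a compact element of $B(A)$.
   Context: For a complete MV-algebra $A$, the Boolean center $B(A)$ is the largest Boolean subalgebra of $A$ (the set of $x$ with $x\oplus x=x$); it is a complete Boolean algebra. The pseudocomplement of $z\in A$ is $z^\ast=\bigvee\{x\in A: x\wedge z=0\}$, and $z^{\ast\ast}=(z^\ast)^\ast$. An element $a$ of a complete lattice $L$ is compact if whenever $a\le\bigvee S$ for some $S\subseteq L$, there is a finite $F\subseteq S$ with $a\le\bigvee F$. Compactness in $B(A)$ refers to joins of subsets of $B(A)$ computed in $B(A)$. -}

module Defs where

open import Level using (Level; _⊔_) renaming (suc to lsuc)
open import Relation.Binary.PropositionalEquality using (_≡_)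
open import Data.Product using (Σ; _×_; ∃)
open import Data.List using (List)
open import Data.List.Membership.Propositional using (_∈_)

record MVAlgebra (c : Level) : Set (lsuc c) where
  infixl 6 _⊕_
  field
    Carrier  : Set c
    _⊕_      : Carrier → Carrier → Carrier
    ¬_       : Carrier → Carrier
    𝟘        : Carrier
    ⊕-assoc  : ∀ x y z → (x ⊕ y) ⊕ z ≡ x ⊕ (y ⊕ z)
    ⊕-comm   : ∀ x y → x ⊕ y ≡ y ⊕ x
    ⊕-identityʳ : ∀ x → x ⊕ 𝟘 ≡ x
    ¬-involutive : ∀ x → ¬ (¬ x) ≡ x
    ⊕-absorb : ∀ x → x ⊕ (¬ 𝟘) ≡ ¬ 𝟘
    mv-law   : ∀ x y → (¬ ((¬ x) ⊕ y)) ⊕ y ≡ (¬ ((¬ y) ⊕ x)) ⊕ x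

  𝟙 : Carrier
  𝟙 = ¬ 𝟘

  _⊙_ : Carrier → Carrier → Carrier
  x ⊙ y = ¬ ((¬ x) ⊕ (¬ y))

  _∧_ : Carrier → Carrier → Carrier
  x ∧ y = x ⊙ ((¬ x) ⊕ y)

  _≤_ : Carrier → Carrier → Set c
  x ≤ y = (¬ x) ⊕ y ≡ 𝟙

  -- Boolean (idempotent) elements: the carrier of the Boolean center B(A)
  IsBoolean : Carrier → Set c
  IsBoolean x = x ⊕ x ≡ x

  IsSup : (Carrier → Set c) → Carrier → Set c
  IsSup S s = (∀ x → S x → x ≤ s) × (∀ u → (∀ x → S x → x ≤ u) → s ≤ u)

  -- s is a least upper bound of S computed in B(A):
  -- s is Boolean, an upper bound of S, and below every Boolean upper bound.
  IsSupB : (Carrier → Set c) → Carrier → Set c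
  IsSupB S s = IsBoolean s × (∀ x → S x → x ≤ s)
             × (∀ u → IsBoolean u → (∀ x → S x → x ≤ u) → s ≤ u)

record CompleteMVAlgebra (c : Level) : Set (lsuc c) where
  field
    mv : MVAlgebra c
  open MVAlgebra mv public
  field
    ⋁     : (Carrier → Set c) → Carrier
    ⋁-sup : ∀ S → IsSup S (⋁ S)

  _* : Carrier → Carrier
  z * = ⋁ (λ x → x ∧ z ≡ 𝟘)

  ⟦_⟧ : List Carrier → Carrier → Set c
  ⟦ F ⟧ x = x ∈ F

  _⊆_ : List Carrier → (Carrier → Set c) → Set c
  F ⊆ S = ∀ x → x ∈ F → S x

  IsCompact : Carrier → Set (lsuc c)
  IsCompact a = ∀ (S : Carrier → Set c) → a ≤ ⋁ S →
                Σ (List Carrier) (λ F → F ⊆ S × a ≤ ⋁ ⟦ F ⟧)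

  -- compact element of the complete Boolean algebra B(A)
  -- (a ∈ B(A); joins are of subsets of B(A), computed in B(A))
  IsCompactB : Carrier → Set (lsuc c)
  IsCompactB a = IsBoolean a ×
    (∀ (S : Carrier → Set c) → (∀ x → S x → IsBoolean x) →
       ∀ s → IsSupB S s → a ≤ s →
       Σ (List Carrier) (λ F → F ⊆ S × ∃ (λ t → IsSupB ⟦ F ⟧ t × a ≤ t)))

{-# OPTIONS --safe #-}

-- The pseudocomplement z* is Boolean: every y disjoint from z satisfies y ≤ y ⊙ ¬ z,
-- so z* ≤ z* ⊙ ¬ z, and iterating this makes z* ⊕ z* disjoint from z, i.e. z* ⊕ z* ≤ z*.
-- A join of Boolean elements is Boolean, because b ≤ b ⊙ b passes to joins; so joins in
-- B(A) are joins in A, and x** is the least Boolean element above x. If x** ≤ ⋁ S with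
-- S ⊆ B(A), then x ≤ ⋁ S, compactness gives a finite F ⊆ S with x ≤ ⋁ F, and since ⋁ F
-- is Boolean, x** ≤ ⋁ F.
module Submission where

open import Level using (Level)
open import Defs
open import Relation.Binary.PropositionalEquality
open import Data.Product using (_,_; proj₁; proj₂)

module MVAlgebraProperties {c : Level} (M : MVAlgebra c) where
  open MVAlgebra M
  open ≡-Reasoning

  _∨_ : Carrier → Carrier → Carrier
  x ∨ y = ¬ ((¬ x) ⊕ y) ⊕ y

  _⊖_ : Carrier → Carrier → Carrier
  x ⊖ y = ¬ ((¬ x) ⊕ y)

  Disjoint : Carrier → Carrier → Set c
  Disjoint x y = x ∧ y ≡ 𝟘

  ¬𝟙≡𝟘 : ¬ 𝟙 ≡ 𝟘
  ¬𝟙≡𝟘 = ¬-involutive 𝟘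

  ⊕-identityˡ : ∀ x → 𝟘 ⊕ x ≡ x
  ⊕-identityˡ x = trans (⊕-comm 𝟘 x) (⊕-identityʳ x)

  ⊕-zeroˡ : ∀ x → 𝟙 ⊕ x ≡ 𝟙
  ⊕-zeroˡ x = trans (⊕-comm 𝟙 x) (⊕-absorb x)

  ∨-comm : ∀ x y → x ∨ y ≡ y ∨ x
  ∨-comm = mv-law

  ¬x⊕x≡𝟙 : ∀ x → (¬ x) ⊕ x ≡ 𝟙
  ¬x⊕x≡𝟙 x = begin
    (¬ x) ⊕ x            ≡⟨ cong (λ w → ¬ w ⊕ x) (sym (trans (cong (_⊕ x) ¬𝟙≡𝟘) (⊕-identityˡ x))) ⟩
    𝟙 ∨ x                ≡⟨ ∨-comm 𝟙 x ⟩
    ¬ ((¬ x) ⊕ 𝟙) ⊕ 𝟙    ≡⟨ ⊕-absorb _ ⟩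
    𝟙                    ∎

  ≤-refl : ∀ {x} → x ≤ x
  ≤-refl {x} = ¬x⊕x≡𝟙 x

  ≤⇒∨≡ : ∀ {x y} → x ≤ y → x ∨ y ≡ y
  ≤⇒∨≡ {x} {y} x≤y = begin
    ¬ ((¬ x) ⊕ y) ⊕ y  ≡⟨ cong (λ w → ¬ w ⊕ y) x≤y ⟩
    ¬ 𝟙 ⊕ y            ≡⟨ cong (_⊕ y) ¬𝟙≡𝟘 ⟩
    𝟘 ⊕ y              ≡⟨ ⊕-identityˡ y ⟩
    y                  ∎

  ≤-antisym : ∀ {x y} → x ≤ y → y ≤ x → x ≡ y
  ≤-antisym {x} {y} x≤y y≤x = begin
    x      ≡⟨ sym (≤⇒∨≡ y≤x) ⟩
    y ∨ x  ≡⟨ ∨-comm y x ⟩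
    x ∨ y  ≡⟨ ≤⇒∨≡ x≤y ⟩
    y      ∎

  x⊕[y⊖x]≡y : ∀ {x y} → x ≤ y → x ⊕ (y ⊖ x) ≡ y
  x⊕[y⊖x]≡y {x} {y} x≤y = begin
    x ⊕ (y ⊖ x)  ≡⟨ ⊕-comm x _ ⟩
    y ∨ x        ≡⟨ ∨-comm y x ⟩
    x ∨ y        ≡⟨ ≤⇒∨≡ x≤y ⟩
    y            ∎

  x⊕z≡y⇒x≤y : ∀ {x y z} → x ⊕ z ≡ y → x ≤ y
  x⊕z≡y⇒x≤y {x} {y} {z} x⊕z≡y = begin
    (¬ x) ⊕ y          ≡⟨ cong ((¬ x) ⊕_) (sym x⊕z≡y) ⟩
    (¬ x) ⊕ (x ⊕ z)    ≡⟨ sym (⊕-assoc _ _ _) ⟩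
    ((¬ x) ⊕ x) ⊕ z    ≡⟨ cong (_⊕ z) (¬x⊕x≡𝟙 x) ⟩
    𝟙 ⊕ z              ≡⟨ ⊕-zeroˡ z ⟩
    𝟙                  ∎

  x≤x⊕y : ∀ {x y} → x ≤ (x ⊕ y)
  x≤x⊕y = x⊕z≡y⇒x≤y refl

  ≤-trans : ∀ {x y z} → x ≤ y → y ≤ z → x ≤ z
  ≤-trans {x} {y} {z} x≤y y≤z = x⊕z≡y⇒x≤y (begin
    x ⊕ ((y ⊖ x) ⊕ (z ⊖ y))  ≡⟨ sym (⊕-assoc _ _ _) ⟩
    (x ⊕ (y ⊖ x)) ⊕ (z ⊖ y)  ≡⟨ cong (_⊕ (z ⊖ y)) (x⊕[y⊖x]≡y x≤y) ⟩
    y ⊕ (z ⊖ y)              ≡⟨ x⊕[y⊖x]≡y y≤z ⟩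
    z                        ∎)

  ⊕-monoˡ-≤ : ∀ {x y} w → x ≤ y → (x ⊕ w) ≤ (y ⊕ w)
  ⊕-monoˡ-≤ {x} {y} w x≤y = x⊕z≡y⇒x≤y (begin
    (x ⊕ w) ⊕ (y ⊖ x)  ≡⟨ ⊕-assoc _ _ _ ⟩
    x ⊕ (w ⊕ (y ⊖ x))  ≡⟨ cong (x ⊕_) (⊕-comm w _) ⟩
    x ⊕ ((y ⊖ x) ⊕ w)  ≡⟨ sym (⊕-assoc _ _ _) ⟩
    (x ⊕ (y ⊖ x)) ⊕ w  ≡⟨ cong (_⊕ w) (x⊕[y⊖x]≡y x≤y) ⟩
    y ⊕ w              ∎)

  ⊕-mono-≤ : ∀ {x y u v} → x ≤ y → u ≤ v → (x ⊕ u) ≤ (y ⊕ v)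
  ⊕-mono-≤ {x} {y} {u} {v} x≤y u≤v = ≤-trans (⊕-monoˡ-≤ u x≤y)
    (subst₂ _≤_ (⊕-comm u y) (⊕-comm v y) (⊕-monoˡ-≤ y u≤v))

  ¬-antimono-≤ : ∀ {x y} → x ≤ y → (¬ y) ≤ (¬ x)
  ¬-antimono-≤ {x} {y} x≤y = trans (cong (_⊕ (¬ x)) (¬-involutive y)) (trans (⊕-comm y (¬ x)) x≤y)

  ¬-⊕ : ∀ x y → ¬ (x ⊕ y) ≡ (¬ x) ⊙ (¬ y)
  ¬-⊕ x y = cong ¬_ (sym (cong₂ _⊕_ (¬-involutive x) (¬-involutive y)))

  ⊙-comm : ∀ x y → x ⊙ y ≡ y ⊙ x
  ⊙-comm x y = cong ¬_ (⊕-comm _ _)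

  ⊙-assoc : ∀ x y z → (x ⊙ y) ⊙ z ≡ x ⊙ (y ⊙ z)
  ⊙-assoc x y z = cong ¬_ (begin
    ¬ (¬ ((¬ x) ⊕ (¬ y))) ⊕ (¬ z)  ≡⟨ cong (_⊕ (¬ z)) (¬-involutive _) ⟩
    ((¬ x) ⊕ (¬ y)) ⊕ (¬ z)        ≡⟨ ⊕-assoc _ _ _ ⟩
    (¬ x) ⊕ ((¬ y) ⊕ (¬ z))        ≡⟨ cong ((¬ x) ⊕_) (sym (¬-involutive _)) ⟩
    (¬ x) ⊕ ¬ (¬ ((¬ y) ⊕ (¬ z)))  ∎)

  ⊙-mono-≤ : ∀ {x y u v} → x ≤ y → u ≤ v → (x ⊙ u) ≤ (y ⊙ v)
  ⊙-mono-≤ x≤y u≤v = ¬-antimono-≤ (⊕-mono-≤ (¬-antimono-≤ x≤y) (¬-antimono-≤ u≤v))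

  ⊙-monoˡ-≤ : ∀ {x y} w → x ≤ y → (x ⊙ w) ≤ (y ⊙ w)
  ⊙-monoˡ-≤ w x≤y = ⊙-mono-≤ x≤y (≤-refl {w})

  ⊙-monoʳ-≤ : ∀ {x y} w → x ≤ y → (w ⊙ x) ≤ (w ⊙ y)
  ⊙-monoʳ-≤ w x≤y = ⊙-mono-≤ (≤-refl {w}) x≤y

  x⊙y≤x : ∀ {x y} → (x ⊙ y) ≤ x
  x⊙y≤x {x} {y} = ≤-trans (¬-antimono-≤ (x≤x⊕y {¬ x} {¬ y})) (subst (_≤ x) (sym (¬-involutive x)) ≤-refl)

  x⊙y≤y : ∀ {x y} → (x ⊙ y) ≤ y
  x⊙y≤y {x} {y} = subst (_≤ y) (⊙-comm y x) x⊙y≤x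

  ∧-comm : ∀ x y → x ∧ y ≡ y ∧ x
  ∧-comm x y = cong ¬_ (begin
    (¬ x) ⊕ ¬ ((¬ x) ⊕ y)        ≡⟨ ⊕-comm _ _ ⟩
    ¬ ((¬ x) ⊕ y) ⊕ (¬ x)        ≡⟨ cong (λ w → ¬ w ⊕ (¬ x)) (⊕-comm _ _) ⟩
    ¬ (y ⊕ (¬ x)) ⊕ (¬ x)        ≡⟨ cong (λ w → ¬ (w ⊕ (¬ x)) ⊕ (¬ x)) (sym (¬-involutive y)) ⟩
    (¬ y) ∨ (¬ x)                ≡⟨ ∨-comm (¬ y) (¬ x) ⟩
    ¬ (¬ (¬ x) ⊕ (¬ y)) ⊕ (¬ y)  ≡⟨ cong (λ w → ¬ (w ⊕ (¬ y)) ⊕ (¬ y)) (¬-involutive x) ⟩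
    ¬ (x ⊕ (¬ y)) ⊕ (¬ y)        ≡⟨ cong (λ w → ¬ w ⊕ (¬ y)) (⊕-comm _ _) ⟩
    ¬ ((¬ y) ⊕ x) ⊕ (¬ y)        ≡⟨ ⊕-comm _ _ ⟩
    (¬ y) ⊕ ¬ ((¬ y) ⊕ x)        ∎)

  ¬-∧ : ∀ x y → ¬ (x ∧ y) ≡ (¬ x) ⊕ (x ⊙ (¬ y))
  ¬-∧ x y = begin
    ¬ (x ∧ y)                       ≡⟨ ¬-involutive _ ⟩
    (¬ x) ⊕ ¬ ((¬ x) ⊕ y)           ≡⟨ cong (λ w → (¬ x) ⊕ ¬ ((¬ x) ⊕ w)) (sym (¬-involutive y)) ⟩
    (¬ x) ⊕ ¬ ((¬ x) ⊕ ¬ (¬ y))     ∎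

  Disjoint-sym : ∀ {x y} → Disjoint x y → Disjoint y x
  Disjoint-sym {x} {y} x∧y≡𝟘 = trans (∧-comm y x) x∧y≡𝟘

  Disjoint⇒≤⊙¬ : ∀ {x y} → Disjoint x y → x ≤ (x ⊙ (¬ y))
  Disjoint⇒≤⊙¬ {x} {y} x∧y≡𝟘 = trans (sym (¬-∧ x y)) (cong ¬_ x∧y≡𝟘)

  ≤⊙¬⇒Disjoint : ∀ {x y} → x ≤ (x ⊙ (¬ y)) → Disjoint x y
  ≤⊙¬⇒Disjoint {x} {y} x≤x⊙¬y = begin
    x ∧ y            ≡⟨ sym (¬-involutive _) ⟩
    ¬ (¬ (x ∧ y))    ≡⟨ cong ¬_ (trans (¬-∧ x y) x≤x⊙¬y) ⟩
    ¬ 𝟙              ≡⟨ ¬𝟙≡𝟘 ⟩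
    𝟘                ∎

  Disjoint⇒≤¬ : ∀ {x y} → Disjoint x y → x ≤ (¬ y)
  Disjoint⇒≤¬ x∧y≡𝟘 = ≤-trans (Disjoint⇒≤⊙¬ x∧y≡𝟘) x⊙y≤y

  Disjoint-antimonoʳ : ∀ {x y z} → y ≤ z → Disjoint x z → Disjoint x y
  Disjoint-antimonoʳ {x} y≤z x∧z≡𝟘 =
    ≤⊙¬⇒Disjoint (≤-trans (Disjoint⇒≤⊙¬ x∧z≡𝟘) (⊙-monoʳ-≤ x (¬-antimono-≤ y≤z)))

  Disjoint-⊕-self : ∀ {x y} → Disjoint x y → Disjoint x (y ⊕ y)
  Disjoint-⊕-self {x} {y} x∧y≡𝟘 = ≤⊙¬⇒Disjoint (subst (x ≤_) x⊙¬y⊙¬y≡x⊙¬[y⊕y]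
    (≤-trans x≤x⊙¬y (⊙-monoˡ-≤ (¬ y) x≤x⊙¬y)))
    where
    x≤x⊙¬y : x ≤ (x ⊙ (¬ y))
    x≤x⊙¬y = Disjoint⇒≤⊙¬ x∧y≡𝟘

    x⊙¬y⊙¬y≡x⊙¬[y⊕y] : (x ⊙ (¬ y)) ⊙ (¬ y) ≡ x ⊙ (¬ (y ⊕ y))
    x⊙¬y⊙¬y≡x⊙¬[y⊕y] = trans (⊙-assoc _ _ _) (cong (x ⊙_) (sym (¬-⊕ y y)))

  ¬-Disjoint⇒Boolean : ∀ {u} → Disjoint (¬ u) u → IsBoolean u
  ¬-Disjoint⇒Boolean {u} ¬u∧u≡𝟘 = ≤-antisym u⊕u≤u x≤x⊕y
    where
    u⊕u≤u : (u ⊕ u) ≤ u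
    u⊕u≤u = subst₂ _≤_ (trans (cong ¬_ (sym (¬-⊕ u u))) (¬-involutive _)) (¬-involutive u)
      (¬-antimono-≤ (Disjoint⇒≤⊙¬ ¬u∧u≡𝟘))

  Boolean⇒¬-Disjoint : ∀ {b} → IsBoolean b → Disjoint (¬ b) b
  Boolean⇒¬-Disjoint {b} b⊕b≡b =
    ≤⊙¬⇒Disjoint (subst ((¬ b) ≤_) (trans (cong ¬_ (sym b⊕b≡b)) (¬-⊕ b b)) ≤-refl)

  ¬-Boolean : ∀ {b} → IsBoolean b → IsBoolean (¬ b)
  ¬-Boolean {b} b-bool = ¬-Disjoint⇒Boolean
    (subst (λ w → Disjoint w (¬ b)) (sym (¬-involutive b)) (Disjoint-sym (Boolean⇒¬-Disjoint b-bool)))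

  Boolean⇒≤⊙-self : ∀ {b} → IsBoolean b → b ≤ (b ⊙ b)
  Boolean⇒≤⊙-self {b} b-bool = subst (λ w → b ≤ (b ⊙ w)) (¬-involutive b)
    (Disjoint⇒≤⊙¬ (Disjoint-sym (Boolean⇒¬-Disjoint b-bool)))

  ≤⊙-self⇒Boolean : ∀ {u} → u ≤ (u ⊙ u) → IsBoolean u
  ≤⊙-self⇒Boolean {u} u≤u⊙u = ¬-Disjoint⇒Boolean
    (Disjoint-sym (≤⊙¬⇒Disjoint (subst (λ w → u ≤ (u ⊙ w)) (sym (¬-involutive u)) u≤u⊙u)))

module CompleteMVAlgebraProperties {c : Level} (A : CompleteMVAlgebra c) where
  open CompleteMVAlgebra A
  open MVAlgebraProperties mv
  open ≡-Reasoning

  ⋁-upper : ∀ {S x} → S x → x ≤ ⋁ S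
  ⋁-upper {S} {x} = proj₁ (⋁-sup S) x

  ⋁-least : ∀ {S u} → (∀ x → S x → x ≤ u) → ⋁ S ≤ u
  ⋁-least {S} {u} = proj₂ (⋁-sup S) u

  ⋁-Boolean : ∀ {S} → (∀ x → S x → IsBoolean x) → IsBoolean (⋁ S)
  ⋁-Boolean S-bool = ≤⊙-self⇒Boolean (⋁-least λ b b∈S →
    ≤-trans (Boolean⇒≤⊙-self (S-bool b b∈S)) (⊙-mono-≤ (⋁-upper b∈S) (⋁-upper b∈S)))

  ⋁-IsSupB : ∀ {S} → (∀ x → S x → IsBoolean x) → IsSupB S (⋁ S)
  ⋁-IsSupB S-bool = ⋁-Boolean S-bool , (λ _ → ⋁-upper) , (λ _ _ → ⋁-least)

  IsSupB⇒≤⋁ : ∀ {S s} → (∀ x → S x → IsBoolean x) → IsSupB S s → s ≤ ⋁ S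
  IsSupB⇒≤⋁ S-bool (_ , _ , s-least) = s-least _ (⋁-Boolean S-bool) (λ _ → ⋁-upper)

  Disjoint-*ˡ : ∀ z → Disjoint (z *) z
  Disjoint-*ˡ z = ≤⊙¬⇒Disjoint (⋁-least λ y y∧z≡𝟘 →
    ≤-trans (Disjoint⇒≤⊙¬ y∧z≡𝟘) (⊙-monoˡ-≤ (¬ z) (⋁-upper y∧z≡𝟘)))

  *-Boolean : ∀ z → IsBoolean (z *)
  *-Boolean z = ≤-antisym (⋁-upper z*⊕z*∧z≡𝟘) x≤x⊕y
    where
    z*⊕z*∧z≡𝟘 : Disjoint ((z *) ⊕ (z *)) z
    z*⊕z*∧z≡𝟘 = Disjoint-sym (Disjoint-⊕-self (Disjoint-sym (Disjoint-*ˡ z)))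

  *-antimono-≤ : ∀ {x y} → x ≤ y → (y *) ≤ (x *)
  *-antimono-≤ x≤y = ⋁-upper (Disjoint-antimonoʳ x≤y (Disjoint-*ˡ _))

  x≤x** : ∀ x → x ≤ ((x *) *)
  x≤x** x = ⋁-upper (Disjoint-sym (Disjoint-*ˡ x))

  Boolean⇒*≡¬ : ∀ {b} → IsBoolean b → b * ≡ ¬ b
  Boolean⇒*≡¬ {b} b-bool =
    ≤-antisym (Disjoint⇒≤¬ (Disjoint-*ˡ b)) (⋁-upper (Boolean⇒¬-Disjoint b-bool))

  Boolean⇒**≡id : ∀ {b} → IsBoolean b → (b *) * ≡ b
  Boolean⇒**≡id {b} b-bool = begin
    (b *) *    ≡⟨ cong _* (Boolean⇒*≡¬ b-bool) ⟩
    (¬ b) *    ≡⟨ Boolean⇒*≡¬ (¬-Boolean b-bool) ⟩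
    ¬ (¬ b)    ≡⟨ ¬-involutive b ⟩
    b          ∎

  x≤b⇒x**≤b : ∀ {x b} → IsBoolean b → x ≤ b → ((x *) *) ≤ b
  x≤b⇒x**≤b {x} b-bool x≤b =
    subst (((x *) *) ≤_) (Boolean⇒**≡id b-bool) (*-antimono-≤ (*-antimono-≤ x≤b))

lemma2p1 : {c : Level} (A : CompleteMVAlgebra c) →
    let open CompleteMVAlgebra A in
      ∀ (x : Carrier) → IsCompact x → IsCompactB ((x *) *)
lemma2p1 A x x-compact = *-Boolean (x *) , λ S S-bool s s-sup x**≤s →
  let x≤⋁S = ≤-trans (x≤x** x) (≤-trans x**≤s (IsSupB⇒≤⋁ S-bool s-sup))
      (F , F⊆S , x≤⋁F) = x-compact S x≤⋁S
      F-bool = λ y y∈F → S-bool y (F⊆S y y∈F)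
  in F , F⊆S , ⋁ ⟦ F ⟧ , ⋁-IsSupB F-bool , x≤b⇒x**≤b (⋁-Boolean F-bool) x≤⋁F
  where
  open CompleteMVAlgebra A
  open MVAlgebraProperties mv
  open CompleteMVAlgebraProperties A
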